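{- Let $c_s>0$ be a constant, and let $S$ be a deterministic subset sum algorithm with parameter $N$ that solves at least a $\frac{1}{\log^{c_s}N}$ fraction of the legal subset sum inputs with parameter $N$. For $A=(a_1,\dots,a_r)$ with $a_1,\dots,a_r$ chosen independently and uniformly from $\{0,\dots,N-1\}$, $$\Pr_A\Big[|S(A)|\ge\frac{N}{4\log^{c_s}N}\Big]=\Omega\Big(\frac{1}{\log^{c_s}N}\Big).$$
   Context: Subset sum with parameter $N$: an input is $A=(a_1,\dots,a_r)$, $a_i\in\{0,\dots,N-1\}$, and $t\in\{0,\dots,N-1\}$, with $r=\log_2 N+4$; an output is $B\subseteq\{1,\dots,r\}$ with $\sum_{i\in B}a_i\equiv t\pmod N$; the input $(A,t)$ is legal if such $B$ exists. A subset sum algorithm $S$ returns on input $(A,t)$ either such a set $B$ (denoted $S(A,t)$) or "error"; it solves a $\delta$ fraction of legal inputs if for uniformly random legal $(A,t)$ it returns a set with probability at least $\delta$. $S(A)=\{t\in\{0,\dots,N-1\}: S(A,t)\neq\text{error}\}$.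
   Formalization: The constant $c_s$ ranges over the positive rationals, and log is the logarithm to base 2. -}

module Defs where

open import Data.Nat using (ℕ; zero; suc; _+_; _*_; _^_; _≤_)
open import Data.Nat.DivMod using (_%_)
open import Data.Nat.Properties using (m^n≢0)
open import Data.Fin using (Fin; toℕ)
open import Data.Fin.Subset using (Subset; inside; outside)
open import Data.Fin.Subset.Properties using (anySubset?)
open import Data.Vec using (Vec; []; _∷_)
open import Data.List using (List; map; allFin)
open import Data.Nat.ListAction using (sum)
open import Data.Maybe using (Maybe; just; nothing; is-just)
open import Data.Bool using (Bool; true; false; if_then_else_)
open import Data.Product using (Σ; ∃; _,_)
open import Relation.Binary.PropositionalEquality using (_≡_)
open import Relation.Nullary using (Dec; does)
open import Data.Nat.Properties using (_≟_)

-- The parameter is N = 2 ^ n, so log₂ N = n and r = n + 4.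
Nof : ℕ → ℕ
Nof n = 2 ^ n

rof : ℕ → ℕ
rof n = n + 4

modN : ℕ → ℕ → ℕ
modN n x = _%_ x (2 ^ n) ⦃ m^n≢0 2 n ⦄

ssum : ∀ {M r} → Vec (Fin M) r → Subset r → ℕ
ssum []       []             = 0
ssum (a ∷ A) (inside  ∷ B)  = toℕ a + ssum A B
ssum (a ∷ A) (outside ∷ B)  = ssum A B

Input : ℕ → Set
Input n = Vec (Fin (Nof n)) (rof n)

Solves : (n : ℕ) → Input n → Fin (Nof n) → Subset (rof n) → Set
Solves n A t B = modN n (ssum A B) ≡ toℕ t

Legal : (n : ℕ) → Input n → Fin (Nof n) → Set
Legal n A t = ∃ λ B → Solves n A t B

legal? : (n : ℕ) → (A : Input n) → (t : Fin (Nof n)) → Dec (Legal n A t)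
legal? n A t = anySubset? (λ B → modN n (ssum A B) ≟ toℕ t)

record SubsetSumAlg (n : ℕ) : Set where
  field
    run     : Input n → Fin (Nof n) → Maybe (Subset (rof n))
    correct : ∀ A t B → run A t ≡ just B → Solves n A t B
open SubsetSumAlg public

b2n : Bool → ℕ
b2n true  = 1
b2n false = 0

sumFin : (k : ℕ) → (Fin k → ℕ) → ℕ
sumFin k f = sum (map f (allFin k))

sumVec : (M r : ℕ) → (Vec (Fin M) r → ℕ) → ℕ
sumVec M zero    f = f []
sumVec M (suc r) f = sumFin M (λ a → sumVec M r (λ v → f (a ∷ v)))

imageSize : ∀ {n} → SubsetSumAlg n → Input n → ℕ
imageSize {n} S A = sumFin (Nof n) (λ t → b2n (is-just (run S A t)))

numLegal : ℕ → ℕ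
numLegal n = sumVec (Nof n) (rof n) (λ A → sumFin (Nof n) (λ t → b2n (does (legal? n A t))))

numSolved : ∀ {n} → SubsetSumAlg n → ℕ
numSolved {n} S = sumVec (Nof n) (rof n)
  (λ A → sumFin (Nof n) (λ t → if does (legal? n A t) then b2n (is-just (run S A t)) else 0))

-- S solves at least a 1 / n^(p/q) fraction of legal inputs:
--   numSolved / numLegal ≥ 1 / n^(p/q)  ⇔  numSolved^q * n^p ≥ numLegal^q
SolvesFraction : (p q : ℕ) → ∀ {n} → SubsetSumAlg n → Set
SolvesFraction p q {n} S = numLegal n ^ q ≤ numSolved S ^ q * n ^ p

-- |S(A)| ≥ N / (4 n^(p/q))  ⇔  (4 |S(A)|)^q * n^p ≥ N^q
LargeImage : (p q : ℕ) → ∀ {n} → SubsetSumAlg n → Input n → Bool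
LargeImage p q {n} S A = does (Nof n ^ q Data.Nat.≤? (4 * imageSize S A) ^ q * n ^ p)

numLarge : (p q : ℕ) → ∀ {n} → SubsetSumAlg n → ℕ
numLarge p q {n} S = sumVec (Nof n) (rof n) (λ A → b2n (LargeImage p q S A))

-- Let Z(A, t) be the number of B with Σ_B A ≡ t (mod N). For fixed A these numbers sum to
-- 2^r = 16N over t, while Σ_{A,t} Z(A, t)² counts the triples (A, B, B′) with Σ_B A ≡ Σ_B′ A;
-- for B ≠ B′ this congruence is a nontrivial condition on a coordinate where B and B′ differ,
-- so it holds for exactly N^r / N vectors A. Since 34 Z ≤ 17² + Z² whenever Z > 0, this
-- second moment bound forces at least 16/17 of all pairs (A, t) to be legal. With
-- j = ⌊n^(p/q)⌋ = ⌊log^{c_s} N⌋, S then solves at least (8/17) N^(r+1) / j pairs, so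
-- Σ_A |S(A)| is at least that large; vectors A with |S(A)| < N / (4j) contribute less than
-- N^(r+1) / (4j) and every other A at most N, which leaves at least (15/68) N^r / j vectors A
-- with |S(A)| ≥ N / (4j).

{-# OPTIONS --safe #-}
module Submission where

open import Defs
open import Data.Nat using (ℕ; _*_; _^_; _≤_; NonZero)
open import Data.Product using (Σ; _×_)
open import Data.Nat using (zero; suc; _+_; _∸_; _<_; _≟_; _≤?_; _<?_; z≤n; s≤s; z<s)
open import Data.Nat.Properties
open import Data.Nat.DivMod using (_%_; m<n⇒m%n≡m; [m+n]%n≡m%n; m%n<n)
open import Data.Nat.ListAction using (sum)
open import Data.Nat.Tactic.RingSolver using (solve-∀)
open import Algebra.Properties.CommutativeSemigroup +-commutativeSemigroup using () renaming (interchange to +-interchange; x∙yz≈xz∙y to x+[y+z]≡x+z+y)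
open import Algebra.Properties.CommutativeSemigroup *-commutativeSemigroup using (xy∙z≈xz∙y; x∙yz≈y∙xz) renaming (interchange to *-interchange)
open import Data.Fin using (Fin; toℕ; zero; suc)
open import Data.Fin.Properties using (toℕ<n)
open import Data.Fin.Subset using (Subset; inside; outside)
open import Data.Vec using (Vec; []; _∷_)
open import Data.Vec.Properties using (≡-dec)
open import Data.List using (List; []; _∷_; map; allFin)
open import Data.List.Properties using (map-cong; map-tabulate)
open import Data.Bool using (true; false; if_then_else_)
import Data.Bool.Properties as Bool
open import Data.Product using (∃; _,_)
open import Data.Sum using ([_,_]′)
open import Function using (_∘_; id)
open import Relation.Binary.PropositionalEquality
open import Relation.Nullary using (¬_; Dec; yes; no; does; contradiction)
open import Relation.Nullary.Decidable using (dec-true; dec-false)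

record IsSummation {I : Set} (∑ : (I → ℕ) → ℕ) : Set where
  field
    ∑-cong      : ∀ {f g} → f ≗ g → ∑ f ≡ ∑ g
    ∑-distrib-+ : ∀ f g → ∑ (λ i → f i + g i) ≡ ∑ f + ∑ g

  ∑-zero : ∑ (λ _ → 0) ≡ 0
  ∑-zero = +-cancelˡ-≡ (∑ (λ _ → 0)) _ _
    (trans (sym (∑-distrib-+ (λ _ → 0) (λ _ → 0))) (sym (+-identityʳ _)))

  ∑-distribˡ-* : ∀ c f → ∑ (λ i → c * f i) ≡ c * ∑ f
  ∑-distribˡ-* zero    f = ∑-zero
  ∑-distribˡ-* (suc c) f = trans (∑-distrib-+ f (λ i → c * f i)) (cong (∑ f +_) (∑-distribˡ-* c f))

  ∑-distribʳ-* : ∀ f c → ∑ (λ i → f i * c) ≡ ∑ f * c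
  ∑-distribʳ-* f c = trans (∑-cong (λ i → *-comm (f i) c)) (trans (∑-distribˡ-* c f) (*-comm c (∑ f)))

  ∑-const : ∀ c → ∑ (λ _ → c) ≡ c * ∑ (λ _ → 1)
  ∑-const c = trans (∑-cong (λ _ → sym (*-identityʳ c))) (∑-distribˡ-* c (λ _ → 1))

  ∑-mono-≤ : ∀ {f g} → (∀ i → f i ≤ g i) → ∑ f ≤ ∑ g
  ∑-mono-≤ {f} {g} f≤g = subst (∑ f ≤_)
    (trans (sym (∑-distrib-+ f (λ i → g i ∸ f i))) (∑-cong (λ i → m+[n∸m]≡n (f≤g i))))
    (m≤m+n (∑ f) _)

open IsSummation

_⊗_ : {I J : Set} → ((I → ℕ) → ℕ) → ((J → ℕ) → ℕ) → (I × J → ℕ) → ℕ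
(∑ ⊗ ∑′) f = ∑ (λ i → ∑′ (λ j → f (i , j)))

⊗-isSummation : {I J : Set} {∑ : (I → ℕ) → ℕ} {∑′ : (J → ℕ) → ℕ} →
                IsSummation ∑ → IsSummation ∑′ → IsSummation (∑ ⊗ ∑′)
⊗-isSummation s s′ = record
  { ∑-cong      = λ f≗g → ∑-cong s (λ i → ∑-cong s′ (λ j → f≗g (i , j)))
  ; ∑-distrib-+ = λ f g → trans (∑-cong s (λ i → ∑-distrib-+ s′ _ _)) (∑-distrib-+ s _ _)
  }

∑-*-∑ : {I J : Set} {∑ : (I → ℕ) → ℕ} {∑′ : (J → ℕ) → ℕ} → IsSummation ∑ → IsSummation ∑′ →
        ∀ f g → ∑ f * ∑′ g ≡ (∑ ⊗ ∑′) (λ (i , j) → f i * g j)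
∑-*-∑ {∑′ = ∑′} s s′ f g =
  trans (sym (∑-distribʳ-* s f (∑′ g))) (∑-cong s (λ i → sym (∑-distribˡ-* s′ (f i) g)))

sumList : {I : Set} → List I → (I → ℕ) → ℕ
sumList xs f = sum (map f xs)

sumList-isSummation : {I : Set} (xs : List I) → IsSummation (sumList xs)
sumList-isSummation xs = record { ∑-cong = λ f≗g → cong sum (map-cong f≗g xs) ; ∑-distrib-+ = distrib xs }
  where
  distrib : ∀ xs f g → sumList xs (λ i → f i + g i) ≡ sumList xs f + sumList xs g
  distrib []       f g = refl
  distrib (x ∷ xs) f g = trans (cong (f x + g x +_) (distrib xs f g)) (+-interchange (f x) (g x) _ _)

sumList-comm : ∀ {I J : Set} {∑ : (J → ℕ) → ℕ} → IsSummation ∑ →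
  (xs : List I) (f : I → J → ℕ) → sumList xs (λ i → ∑ (f i)) ≡ ∑ (λ j → sumList xs (λ i → f i j))
sumList-comm s []       f = sym (∑-zero s)
sumList-comm {∑ = ∑} s (x ∷ xs) f = trans (cong (∑ (f x) +_) (sumList-comm s xs f)) (sym (∑-distrib-+ s _ _))

sumFin-isSummation : ∀ k → IsSummation (sumFin k)
sumFin-isSummation k = sumList-isSummation (allFin k)

sumFin-suc : ∀ k f → sumFin (suc k) f ≡ f zero + sumFin k (f ∘ suc)
sumFin-suc k f = cong (λ xs → f zero + sum xs) (trans (map-tabulate suc f) (sym (map-tabulate id (f ∘ suc))))

sumFin-ones : ∀ k → sumFin k (λ _ → 1) ≡ k
sumFin-ones zero    = refl
sumFin-ones (suc k) = trans (sumFin-suc k (λ _ → 1)) (cong suc (sumFin-ones k))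

sumVec-isSummation : ∀ M r → IsSummation (sumVec M r)
sumVec-isSummation M zero    = record { ∑-cong = λ f≗g → f≗g [] ; ∑-distrib-+ = λ f g → refl }
sumVec-isSummation M (suc r) = record
  { ∑-cong      = λ f≗g → ∑-cong (sumFin-isSummation M) (λ a →
                            ∑-cong (sumVec-isSummation M r) (λ A → f≗g (a ∷ A)))
  ; ∑-distrib-+ = λ f g → trans (∑-cong (sumFin-isSummation M) (λ a → ∑-distrib-+ (sumVec-isSummation M r) _ _))
                                (∑-distrib-+ (sumFin-isSummation M) _ _)
  }

sumVec-comm : ∀ {J : Set} {∑ : (J → ℕ) → ℕ} → IsSummation ∑ →
  ∀ M r (f : Vec (Fin M) r → J → ℕ) →
  sumVec M r (λ A → ∑ (f A)) ≡ ∑ (λ j → sumVec M r (λ A → f A j))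
sumVec-comm s M zero    f = refl
sumVec-comm s M (suc r) f = trans (∑-cong (sumFin-isSummation M) (λ a → sumVec-comm s M r (f ∘ (a ∷_))))
                                  (sumList-comm s (allFin M) _)

sumVec-ones : ∀ M r → sumVec M r (λ _ → 1) ≡ M ^ r
sumVec-ones M zero    = refl
sumVec-ones M (suc r) = begin
  sumFin M (λ _ → sumVec M r (λ _ → 1)) ≡⟨ ∑-cong (sumFin-isSummation M) (λ _ → sumVec-ones M r) ⟩
  sumFin M (λ _ → M ^ r)                ≡⟨ ∑-const (sumFin-isSummation M) (M ^ r) ⟩
  M ^ r * sumFin M (λ _ → 1)            ≡⟨ cong (M ^ r *_) (sumFin-ones M) ⟩
  M ^ r * M                             ≡⟨ *-comm (M ^ r) M ⟩
  M ^ suc r                             ∎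
  where open ≡-Reasoning

sumSubset : ∀ r → (Subset r → ℕ) → ℕ
sumSubset zero    f = f []
sumSubset (suc r) f = sumSubset r (f ∘ (inside ∷_)) + sumSubset r (f ∘ (outside ∷_))

sumSubset-isSummation : ∀ r → IsSummation (sumSubset r)
sumSubset-isSummation zero    = record { ∑-cong = λ f≗g → f≗g [] ; ∑-distrib-+ = λ f g → refl }
sumSubset-isSummation (suc r) = record
  { ∑-cong      = λ f≗g → cong₂ _+_ (∑-cong s (f≗g ∘ (inside ∷_))) (∑-cong s (f≗g ∘ (outside ∷_)))
  ; ∑-distrib-+ = λ f g → trans (cong₂ _+_ (∑-distrib-+ s _ _) (∑-distrib-+ s _ _))
                             (+-interchange (sumSubset r (f ∘ (inside ∷_))) (sumSubset r (g ∘ (inside ∷_))) _ _)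
  }
  where
  s = sumSubset-isSummation r

sumSubset-ones : ∀ r → sumSubset r (λ _ → 1) ≡ 2 ^ r
sumSubset-ones zero    = refl
sumSubset-ones (suc r) = trans (cong₂ _+_ (sumSubset-ones r) (sumSubset-ones r)) (cong (2 ^ r +_) (sym (+-identityʳ _)))

𝟙 : {P : Set} → Dec P → ℕ
𝟙 d = b2n (does d)

b2n≤1 : ∀ b → b2n b ≤ 1
b2n≤1 true  = ≤-refl
b2n≤1 false = z≤n

δ : ℕ → ℕ → ℕ
δ u v = 𝟙 (u ≟ v)

δ-sym : ∀ u v → δ u v ≡ δ v u
δ-sym zero    zero    = refl
δ-sym zero    (suc v) = refl
δ-sym (suc u) zero    = refl
δ-sym (suc u) (suc v) = δ-sym u v

δ-≢ : ∀ {u v} → u ≢ v → δ u v ≡ 0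
δ-≢ {u} {v} u≢v = cong b2n (dec-false (u ≟ v) u≢v)

δ-*-δ : ∀ u v t → δ u t * δ v t ≡ δ u t * δ u v
δ-*-δ u v t with u ≟ t
... | yes refl = cong (δ u u *_) (δ-sym v u)
... | no u≢t   = trans (cong (_* δ v t) (δ-≢ u≢t)) (cong (_* δ u v) (sym (δ-≢ u≢t)))

sumFin-δ : ∀ {k v} → v < k → sumFin k (λ t → δ v (toℕ t)) ≡ 1
sumFin-δ {suc k} {zero}  _         =
  trans (sumFin-suc k (λ t → δ 0 (toℕ t))) (cong suc (∑-zero (sumFin-isSummation k)))
sumFin-δ {suc k} {suc v} (s≤s v<k) = trans (sumFin-suc k (λ t → δ (suc v) (toℕ t))) (sumFin-δ v<k)

sumFin-δ-*-δ : ∀ {k u} v → u < k → sumFin k (λ t → δ u (toℕ t) * δ v (toℕ t)) ≡ δ u v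
sumFin-δ-*-δ {k} {u} v u<k = begin
  sumFin k (λ t → δ u (toℕ t) * δ v (toℕ t)) ≡⟨ ∑-cong s (λ t → δ-*-δ u v (toℕ t)) ⟩
  sumFin k (λ t → δ u (toℕ t) * δ u v)       ≡⟨ ∑-distribʳ-* s _ (δ u v) ⟩
  sumFin k (λ t → δ u (toℕ t)) * δ u v       ≡⟨ cong (_* δ u v) (sumFin-δ u<k) ⟩
  1 * δ u v                                  ≡⟨ *-identityˡ (δ u v) ⟩
  δ u v                                      ∎
  where
  open ≡-Reasoning
  s = sumFin-isSummation k

sumFin-snoc : ∀ k (g : ℕ → ℕ) → sumFin (suc k) (g ∘ toℕ) ≡ sumFin k (g ∘ toℕ) + g k
sumFin-snoc zero    g = trans (sumFin-suc 0 (g ∘ toℕ)) (+-identityʳ (g 0))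
sumFin-snoc (suc k) g = begin
  sumFin (suc (suc k)) (g ∘ toℕ)                  ≡⟨ sumFin-suc (suc k) (g ∘ toℕ) ⟩
  g 0 + sumFin (suc k) (g ∘ suc ∘ toℕ)            ≡⟨ cong (g 0 +_) (sumFin-snoc k (g ∘ suc)) ⟩
  g 0 + (sumFin k (g ∘ suc ∘ toℕ) + g (suc k))    ≡⟨ +-assoc (g 0) _ _ ⟨
  g 0 + sumFin k (g ∘ suc ∘ toℕ) + g (suc k)      ≡⟨ cong (_+ g (suc k)) (sumFin-suc k (g ∘ toℕ)) ⟨
  sumFin (suc k) (g ∘ toℕ) + g (suc k)            ∎
  where open ≡-Reasoning

sumFin-rotate : ∀ k (g : ℕ → ℕ) → g k ≡ g 0 → sumFin k (g ∘ suc ∘ toℕ) ≡ sumFin k (g ∘ toℕ)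
sumFin-rotate k g gk≡g0 = +-cancelˡ-≡ (g 0) _ _ (begin
  g 0 + sumFin k (g ∘ suc ∘ toℕ) ≡⟨ sumFin-suc k (g ∘ toℕ) ⟨
  sumFin (suc k) (g ∘ toℕ)       ≡⟨ sumFin-snoc k g ⟩
  sumFin k (g ∘ toℕ) + g k       ≡⟨ cong (sumFin k (g ∘ toℕ) +_) gk≡g0 ⟩
  sumFin k (g ∘ toℕ) + g 0       ≡⟨ +-comm _ (g 0) ⟩
  g 0 + sumFin k (g ∘ toℕ)       ∎)
  where open ≡-Reasoning

sumFin-shift-mod : ∀ N .{{_ : NonZero N}} (h : ℕ → ℕ) x →
  sumFin N (λ a → h ((x + toℕ a) % N)) ≡ sumFin N (h ∘ toℕ)
sumFin-shift-mod N h zero    = ∑-cong (sumFin-isSummation N) (λ a → cong h (m<n⇒m%n≡m (toℕ<n a)))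
sumFin-shift-mod N h (suc x) = begin
  sumFin N (λ a → h ((suc x + toℕ a) % N))
    ≡⟨ ∑-cong (sumFin-isSummation N) (λ a → cong (h ∘ (_% N)) (+-suc x (toℕ a))) ⟨
  sumFin N (g ∘ suc ∘ toℕ)                 ≡⟨ sumFin-rotate N g gN≡g0 ⟩
  sumFin N (g ∘ toℕ)                       ≡⟨ sumFin-shift-mod N h x ⟩
  sumFin N (h ∘ toℕ)                       ∎
  where
  open ≡-Reasoning
  g : ℕ → ℕ
  g b = h ((x + b) % N)
  gN≡g0 : g N ≡ g 0
  gN≡g0 = cong h (trans ([m+n]%n≡m%n x N) (cong (_% N) (sym (+-identityʳ x))))

sumFin-δ-shift : ∀ N .{{_ : NonZero N}} x {w} → w < N → sumFin N (λ a → δ ((x + toℕ a) % N) w) ≡ 1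
sumFin-δ-shift N x {w} w<N = begin
  sumFin N (λ a → δ ((x + toℕ a) % N) w) ≡⟨ sumFin-shift-mod N (λ z → δ z w) x ⟩
  sumFin N (λ a → δ (toℕ a) w)           ≡⟨ ∑-cong (sumFin-isSummation N) (λ a → δ-sym (toℕ a) w) ⟩
  sumFin N (λ a → δ w (toℕ a))           ≡⟨ sumFin-δ w<N ⟩
  1                                      ∎
  where open ≡-Reasoning

_≟ˢ_ : ∀ {r} (B B′ : Subset r) → Dec (B ≡ B′)
_≟ˢ_ = ≡-dec Bool._≟_

sumSubset-𝟙≟ˢ : ∀ {r} (B : Subset r) → sumSubset r (λ B′ → 𝟙 (B ≟ˢ B′)) ≡ 1
sumSubset-𝟙≟ˢ []                  = refl
sumSubset-𝟙≟ˢ {suc r} (true  ∷ B) = cong₂ _+_ (sumSubset-𝟙≟ˢ B) (∑-zero (sumSubset-isSummation r))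
sumSubset-𝟙≟ˢ {suc r} (false ∷ B) = cong₂ _+_ (∑-zero (sumSubset-isSummation r)) (sumSubset-𝟙≟ˢ B)

module Collisions (N : ℕ) .{{_ : NonZero N}} where

  collisions : ∀ {r} → Subset r → Subset r → ℕ → ℕ → ℕ
  collisions {r} B B′ x y = sumVec N r (λ A → δ ((x + ssum A B) % N) ((y + ssum A B′) % N))

  collisions-sym : ∀ {r} (B B′ : Subset r) x y → collisions B B′ x y ≡ collisions B′ B y x
  collisions-sym {r} B B′ x y =
    ∑-cong (sumVec-isSummation N r) (λ A → δ-sym ((x + ssum A B) % N) ((y + ssum A B′) % N))

  -- Summing over the coordinate a where B and B′ differ meets every residue exactly once.
  collisions-inside-outside : ∀ {r} (B B′ : Subset r) x y → collisions (inside ∷ B) (outside ∷ B′) x y ≡ N ^ r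
  collisions-inside-outside {r} B B′ x y = begin
    sumFin N (λ a → sumVec N r (λ A → δ ((x + (toℕ a + ssum A B)) % N) ((y + ssum A B′) % N)))
      ≡⟨ sumVec-comm (sumFin-isSummation N) N r _ ⟨
    sumVec N r (λ A → sumFin N (λ a → δ ((x + (toℕ a + ssum A B)) % N) ((y + ssum A B′) % N)))
      ≡⟨ ∑-cong (sumVec-isSummation N r) (λ A → ∑-cong (sumFin-isSummation N) (λ a →
           cong (λ z → δ (z % N) ((y + ssum A B′) % N)) (x+[y+z]≡x+z+y x (toℕ a) (ssum A B)))) ⟩
    sumVec N r (λ A → sumFin N (λ a → δ ((x + ssum A B + toℕ a) % N) ((y + ssum A B′) % N)))
      ≡⟨ ∑-cong (sumVec-isSummation N r) (λ A → sumFin-δ-shift N (x + ssum A B) (m%n<n _ N)) ⟩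
    sumVec N r (λ _ → 1)
      ≡⟨ sumVec-ones N r ⟩
    N ^ r ∎
    where open ≡-Reasoning

  N*sumFin-≤ : ∀ {r} i {c : Fin N → ℕ} → (∀ a → N * c a ≤ N ^ r + N * N ^ r * i) →
               N * sumFin N c ≤ N ^ suc r + N * N ^ suc r * i
  N*sumFin-≤ {r} i {c} bound = begin
    N * sumFin N c           ≡⟨ ∑-distribˡ-* s N c ⟨
    sumFin N (λ a → N * c a) ≤⟨ ∑-mono-≤ s bound ⟩
    sumFin N (λ _ → U)       ≡⟨ ∑-const s U ⟩
    U * sumFin N (λ _ → 1)   ≡⟨ cong (U *_) (sumFin-ones N) ⟩
    U * N                    ≡⟨ rearrange N (N ^ r) i ⟩
    N ^ suc r + N * N ^ suc r * i ∎
    where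
    open ≤-Reasoning
    s = sumFin-isSummation N
    U = N ^ r + N * N ^ r * i
    rearrange : ∀ N P i → (P + N * P * i) * N ≡ N * P + N * (N * P) * i
    rearrange = solve-∀

  collisions-bound : ∀ {r} (B B′ : Subset r) x y → N * collisions B B′ x y ≤ N ^ r + N * N ^ r * 𝟙 (B ≟ˢ B′)
  collisions-bound [] [] x y = begin
    N * δ ((x + 0) % N) ((y + 0) % N) ≤⟨ *-monoʳ-≤ N (b2n≤1 _) ⟩
    N * 1                             ≡⟨ *-identityʳ (N * 1) ⟨
    N * 1 * 1                         ≤⟨ m≤n+m _ 1 ⟩
    1 + N * 1 * 1                     ∎
    where open ≤-Reasoning
  collisions-bound {suc r} (true ∷ B) (true ∷ B′) x y = begin
    N * collisions (inside ∷ B) (inside ∷ B′) x y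
      ≡⟨ cong (N *_) (∑-cong (sumFin-isSummation N) (λ a → ∑-cong (sumVec-isSummation N r) (λ A →
           cong₂ (λ u v → δ (u % N) (v % N)) (+-assoc x (toℕ a) _) (+-assoc y (toℕ a) _)))) ⟨
    N * sumFin N (λ a → collisions B B′ (x + toℕ a) (y + toℕ a))
      ≤⟨ N*sumFin-≤ {r} (𝟙 (B ≟ˢ B′)) (λ a → collisions-bound B B′ (x + toℕ a) (y + toℕ a)) ⟩
    N ^ suc r + N * N ^ suc r * 𝟙 (B ≟ˢ B′) ∎
    where open ≤-Reasoning
  collisions-bound {suc r} (false ∷ B) (false ∷ B′) x y =
    N*sumFin-≤ {r} (𝟙 (B ≟ˢ B′)) (λ _ → collisions-bound B B′ x y)
  collisions-bound {suc r} (true ∷ B) (false ∷ B′) x y = begin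
    N * collisions (inside ∷ B) (outside ∷ B′) x y ≡⟨ cong (N *_) (collisions-inside-outside B B′ x y) ⟩
    N ^ suc r                                      ≤⟨ m≤m+n _ _ ⟩
    N ^ suc r + N * N ^ suc r * 0                  ∎
    where open ≤-Reasoning
  collisions-bound {suc r} (false ∷ B) (true ∷ B′) x y = begin
    N * collisions (outside ∷ B) (inside ∷ B′) x y ≡⟨ cong (N *_) (collisions-sym (outside ∷ B) (inside ∷ B′) x y) ⟩
    N * collisions (inside ∷ B′) (outside ∷ B) y x ≡⟨ cong (N *_) (collisions-inside-outside B′ B y x) ⟩
    N ^ suc r                                      ≤⟨ m≤m+n _ _ ⟩
    N ^ suc r + N * N ^ suc r * 0                  ∎
    where open ≤-Reasoning

2*m*n≤m*m+n*n : ∀ m n → 2 * m * n ≤ m * m + n * n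
2*m*n≤m*m+n*n m n =
  [ ordered
  , (λ n≤m → subst₂ _≤_ (xy∙z≈xz∙y 2 n m) (+-comm (n * n) (m * m)) (ordered n≤m))
  ]′ (≤-total m n)
  where
  identity : ∀ a d → 2 * a * (a + d) + d * d ≡ a * a + (a + d) * (a + d)
  identity = solve-∀
  ordered : ∀ {a b} → a ≤ b → 2 * a * b ≤ a * a + b * b
  ordered {a} {b} a≤b = subst (λ b → 2 * a * b ≤ a * a + b * b) (m+[n∸m]≡n a≤b)
                          (subst (2 * a * (a + (b ∸ a)) ≤_) (identity a (b ∸ a)) (m≤m+n _ _))

module LegalInputs (n : ℕ) where

  N r M : ℕ
  N = Nof n
  r = rof n
  M = N ^ r

  instance
    N≢0 : NonZero N
    N≢0 = m^n≢0 2 n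

  open Collisions N

  sumInputs : (Input n → ℕ) → ℕ
  sumInputs = sumVec N r

  sumInstances : (Input n × Fin N → ℕ) → ℕ
  sumInstances = sumInputs ⊗ sumFin N

  sumPairs : (Subset r × Subset r → ℕ) → ℕ
  sumPairs = sumSubset r ⊗ sumSubset r

  sumInputs-isSummation : IsSummation sumInputs
  sumInputs-isSummation = sumVec-isSummation N r

  sumInstances-isSummation : IsSummation sumInstances
  sumInstances-isSummation = ⊗-isSummation sumInputs-isSummation (sumFin-isSummation N)

  sumPairs-isSummation : IsSummation sumPairs
  sumPairs-isSummation = ⊗-isSummation (sumSubset-isSummation r) (sumSubset-isSummation r)

  solutionCount : Input n → Fin N → ℕ
  solutionCount A t = sumSubset r (λ B → δ (modN n (ssum A B)) (toℕ t))

  solutionCount-illegal : ∀ A t → ¬ Legal n A t → solutionCount A t ≡ 0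
  solutionCount-illegal A t ¬legal =
    trans (∑-cong s (λ B → δ-≢ (λ solves → ¬legal (B , solves)))) (∑-zero s)
    where s = sumSubset-isSummation r

  sum-solutionCount : ∀ A → sumFin N (solutionCount A) ≡ 2 ^ r
  sum-solutionCount A = begin
    sumFin N (solutionCount A)
      ≡⟨ sumList-comm s (allFin N) _ ⟩
    sumSubset r (λ B → sumFin N (λ t → δ (modN n (ssum A B)) (toℕ t)))
      ≡⟨ ∑-cong s (λ B → sumFin-δ (m%n<n _ N)) ⟩
    sumSubset r (λ _ → 1)
      ≡⟨ sumSubset-ones r ⟩
    2 ^ r ∎
    where
    open ≡-Reasoning
    s = sumSubset-isSummation r

  sum-solutionCount² : ∀ A → sumFin N (λ t → solutionCount A t * solutionCount A t) ≡
                             sumPairs (λ (B , B′) → δ (modN n (ssum A B)) (modN n (ssum A B′)))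
  sum-solutionCount² A = begin
    sumFin N (λ t → solutionCount A t * solutionCount A t)
      ≡⟨ ∑-cong (sumFin-isSummation N) (λ t → ∑-*-∑ s s (λ B → δ (σ B) (toℕ t)) (λ B → δ (σ B) (toℕ t))) ⟩
    sumFin N (λ t → sumPairs (λ (B , B′) → δ (σ B) (toℕ t) * δ (σ B′) (toℕ t)))
      ≡⟨ sumList-comm sumPairs-isSummation (allFin N) _ ⟩
    sumPairs (λ (B , B′) → sumFin N (λ t → δ (σ B) (toℕ t) * δ (σ B′) (toℕ t)))
      ≡⟨ ∑-cong sumPairs-isSummation (λ (B , B′) → sumFin-δ-*-δ (σ B′) (m%n<n _ N)) ⟩
    sumPairs (λ (B , B′) → δ (σ B) (σ B′)) ∎
    where
    open ≡-Reasoning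
    s = sumSubset-isSummation r
    σ : Subset r → ℕ
    σ B = modN n (ssum A B)

  secondMoment : ℕ
  secondMoment = sumInstances (λ (A , t) → solutionCount A t * solutionCount A t)

  secondMoment-bound : N * secondMoment ≤ (2 ^ r + N) * 2 ^ r * M
  secondMoment-bound = begin
    N * secondMoment
      ≡⟨ cong (N *_) (∑-cong sumInputs-isSummation sum-solutionCount²) ⟩
    N * sumInputs (λ A → sumPairs (λ (B , B′) → δ (modN n (ssum A B)) (modN n (ssum A B′))))
      ≡⟨ cong (N *_) (sumVec-comm sumPairs-isSummation N r _) ⟩
    N * sumPairs (λ (B , B′) → collisions B B′ 0 0)
      ≡⟨ ∑-distribˡ-* sumPairs-isSummation N _ ⟨
    sumPairs (λ (B , B′) → N * collisions B B′ 0 0)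
      ≤⟨ ∑-mono-≤ sumPairs-isSummation (λ (B , B′) → collisions-bound B B′ 0 0) ⟩
    sumPairs (λ (B , B′) → M + N * M * 𝟙 (B ≟ˢ B′))
      ≡⟨ ∑-cong s row ⟩
    sumSubset r (λ _ → M * 2 ^ r + N * M)
      ≡⟨ trans (∑-const s _) (cong ((M * 2 ^ r + N * M) *_) (sumSubset-ones r)) ⟩
    (M * 2 ^ r + N * M) * 2 ^ r
      ≡⟨ rearrange M (2 ^ r) N ⟩
    (2 ^ r + N) * 2 ^ r * M ∎
    where
    open ≤-Reasoning
    s = sumSubset-isSummation r
    row : ∀ B → sumSubset r (λ B′ → M + N * M * 𝟙 (B ≟ˢ B′)) ≡ M * 2 ^ r + N * M
    row B = trans (∑-distrib-+ s _ _) (cong₂ _+_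
      (trans (∑-const s M) (cong (M *_) (sumSubset-ones r)))
      (trans (∑-distribˡ-* s (N * M) _) (trans (cong (N * M *_) (sumSubset-𝟙≟ˢ B)) (*-identityʳ (N * M)))))
    rearrange : ∀ M P N → (M * P + N * M) * P ≡ (P + N) * P * M
    rearrange = solve-∀

  solutionCount-tangent : ∀ c A t →
    2 * c * solutionCount A t ≤ c * c * 𝟙 (legal? n A t) + solutionCount A t * solutionCount A t
  solutionCount-tangent c A t with legal? n A t
  ... | yes _ = subst (λ k → 2 * c * Z ≤ k + Z * Z) (sym (*-identityʳ (c * c))) (2*m*n≤m*m+n*n c Z)
    where Z = solutionCount A t
  ... | no ¬legal rewrite solutionCount-illegal A t ¬legal = ≤-reflexive (zeros c)
    where
    zeros : ∀ c → 2 * c * 0 ≡ c * c * 0 + 0 * 0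
    zeros = solve-∀

  legal-tangent-bound : ∀ c → 2 * c * (2 ^ r * M) ≤ c * c * numLegal n + secondMoment
  legal-tangent-bound c = begin
    2 * c * (2 ^ r * M)
      ≡⟨ cong (2 * c *_) total ⟨
    2 * c * sumInstances (λ (A , t) → solutionCount A t)
      ≡⟨ ∑-distribˡ-* s (2 * c) _ ⟨
    sumInstances (λ (A , t) → 2 * c * solutionCount A t)
      ≤⟨ ∑-mono-≤ s (λ (A , t) → solutionCount-tangent c A t) ⟩
    sumInstances (λ (A , t) → c * c * 𝟙 (legal? n A t) + solutionCount A t * solutionCount A t)
      ≡⟨ ∑-distrib-+ s _ _ ⟩
    sumInstances (λ (A , t) → c * c * 𝟙 (legal? n A t)) + secondMoment
      ≡⟨ cong (_+ _) (∑-distribˡ-* s (c * c) _) ⟩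
    c * c * numLegal n + secondMoment ∎
    where
    open ≤-Reasoning
    s = sumInstances-isSummation
    total : sumInstances (λ (A , t) → solutionCount A t) ≡ 2 ^ r * M
    total = trans (∑-cong sumInputs-isSummation sum-solutionCount)
                  (trans (∑-const sumInputs-isSummation (2 ^ r)) (cong (2 ^ r *_) (sumVec-ones N r)))

  legal-fraction : 16 * N * M ≤ 17 * numLegal n
  legal-fraction = *-cancelˡ-≤ (17 * N) {{m*n≢0 17 N}} (+-cancelʳ-≤ (272 * (N * N * M)) _ _ (begin
    17 * N * (16 * N * M) + 272 * (N * N * M)    ≡⟨ double N M ⟩
    N * (2 * 17 * (16 * N * M))                  ≡⟨ cong (λ P → N * (2 * 17 * (P * M))) 2^r≡16N ⟨
    N * (2 * 17 * (2 ^ r * M))                   ≤⟨ *-monoʳ-≤ N (legal-tangent-bound 17) ⟩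
    N * (17 * 17 * L + secondMoment)             ≡⟨ *-distribˡ-+ N (17 * 17 * L) secondMoment ⟩
    N * (17 * 17 * L) + N * secondMoment         ≤⟨ +-monoʳ-≤ _ secondMoment-bound ⟩
    N * (17 * 17 * L) + (2 ^ r + N) * 2 ^ r * M  ≡⟨ cong (λ P → N * (17 * 17 * L) + (P + N) * P * M) 2^r≡16N ⟩
    N * (17 * 17 * L) + (16 * N + N) * (16 * N) * M ≡⟨ collect N M L ⟩
    17 * N * (17 * L) + 272 * (N * N * M) ∎))
    where
    open ≤-Reasoning
    L = numLegal n
    2^r≡16N : 2 ^ r ≡ 16 * N
    2^r≡16N = trans (^-distribˡ-+-* 2 n 4) (*-comm N 16)
    double : ∀ N M → 17 * N * (16 * N * M) + 272 * (N * N * M) ≡ N * (2 * 17 * (16 * N * M))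
    double = solve-∀
    collect : ∀ N M L → N * (17 * 17 * L) + (16 * N + N) * (16 * N) * M ≡ 17 * N * (17 * L) + 272 * (N * N * M)
    collect = solve-∀

^-distrib-* : ∀ a b q → (a * b) ^ q ≡ a ^ q * b ^ q
^-distrib-* a b zero    = refl
^-distrib-* a b (suc q) = trans (cong (a * b *_) (^-distrib-* a b q)) (*-interchange a b (a ^ q) (b ^ q))

^-cancelˡ-< : ∀ q {u v} → u ^ q < v ^ q → u < v
^-cancelˡ-< q {u} {v} uᵠ<vᵠ with v ≤? u
... | yes v≤u = contradiction (^-monoˡ-≤ q v≤u) (<⇒≱ uᵠ<vᵠ)
... | no  v≰u = ≰⇒> v≰u

^-cancelˡ-≤ : ∀ q .{{_ : NonZero q}} {u v} → u ^ q ≤ v ^ q → u ≤ v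
^-cancelˡ-≤ q {u} {v} uᵠ≤vᵠ with u ≤? v
... | yes u≤v = u≤v
... | no  u≰v = contradiction uᵠ≤vᵠ (<⇒≱ (^-monoˡ-< q (≰⇒> u≰v)))

integerRoot : ∀ q .{{_ : NonZero q}} X → ∃ λ j → j ^ q ≤ X × X < suc j ^ q
integerRoot q@(suc _) zero = 0 , z≤n , subst (0 <_) (sym (^-zeroˡ q)) z<s
integerRoot q@(suc _) (suc X) with integerRoot q X
... | j , jᵠ≤X , X<[1+j]ᵠ with suc X <? suc j ^ q
...   | yes 1+X<[1+j]ᵠ = j , m≤n⇒m≤1+n jᵠ≤X , 1+X<[1+j]ᵠ
...   | no  1+X≮[1+j]ᵠ = suc j , ≤-reflexive (sym 1+X≡[1+j]ᵠ) ,
                          subst (_< suc (suc j) ^ q) (sym 1+X≡[1+j]ᵠ) (^-monoˡ-< q (n<1+n (suc j)))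
  where
  1+X≡[1+j]ᵠ : suc X ≡ suc j ^ q
  1+X≡[1+j]ᵠ = ≤-antisym X<[1+j]ᵠ (≮⇒≥ 1+X≮[1+j]ᵠ)

Nᵠ≰Yᵠ*K⇒Y*j<N : ∀ q .{{_ : NonZero q}} {N Y K j} → ¬ N ^ q ≤ Y ^ q * K → j ^ q ≤ K → Y * j < N
Nᵠ≰Yᵠ*K⇒Y*j<N q {N} {Y} {K} {j} Nᵠ≰Yᵠ*K jᵠ≤K = ^-cancelˡ-< q (begin-strict
  (Y * j) ^ q   ≡⟨ ^-distrib-* Y j q ⟩
  Y ^ q * j ^ q ≤⟨ *-monoʳ-≤ (Y ^ q) jᵠ≤K ⟩
  Y ^ q * K     <⟨ ≰⇒> Nᵠ≰Yᵠ*K ⟩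
  N ^ q         ∎)
  where open ≤-Reasoning

module Algorithm (p q : ℕ) .{{_ : NonZero q}} {n : ℕ} .{{_ : NonZero n}} (S : SubsetSumAlg n) where

  open LegalInputs n

  imageSize≤N : ∀ A → imageSize S A ≤ N
  imageSize≤N A = ≤-trans (∑-mono-≤ (sumFin-isSummation N) (λ t → b2n≤1 _)) (≤-reflexive (sumFin-ones N))

  numSolved≤sum-imageSize : numSolved S ≤ sumInputs (imageSize S)
  numSolved≤sum-imageSize = ∑-mono-≤ sumInputs-isSummation (λ A → ∑-mono-≤ (sumFin-isSummation N) (λ t →
    if-0-≤ (does (legal? n A t)) _))
    where
    if-0-≤ : ∀ b x → (if b then x else 0) ≤ x
    if-0-≤ true  x = ≤-refl
    if-0-≤ false x = z≤n

  imageSize-bound : ∀ {j} → j ^ q ≤ n ^ p → ∀ A →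
                    4 * j * imageSize S A ≤ 4 * j * N * b2n (LargeImage p q S A) + N
  imageSize-bound {j} jᵠ≤nᵖ A with N ^ q ≤? (4 * imageSize S A) ^ q * n ^ p
  ... | yes large = begin
    4 * j * imageSize S A                    ≤⟨ *-monoʳ-≤ (4 * j) (imageSize≤N A) ⟩
    4 * j * N                                ≡⟨ *-identityʳ (4 * j * N) ⟨
    4 * j * N * 1                            ≤⟨ m≤m+n _ N ⟩
    4 * j * N * 1 + N                        ≡⟨ cong (λ b → 4 * j * N * b2n b + N) (dec-true (N ^ q ≤? _) large) ⟨
    4 * j * N * b2n (LargeImage p q S A) + N ∎
    where open ≤-Reasoning
  ... | no  small = begin
    4 * j * imageSize S A                    ≡⟨ xy∙z≈xz∙y 4 j (imageSize S A) ⟩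
    4 * imageSize S A * j                    ≤⟨ <⇒≤ (Nᵠ≰Yᵠ*K⇒Y*j<N q small jᵠ≤nᵖ) ⟩
    N                                        ≤⟨ m≤n+m N _ ⟩
    4 * j * N * 0 + N                        ≡⟨ cong (λ b → 4 * j * N * b2n b + N) (dec-false (N ^ q ≤? _) small) ⟨
    4 * j * N * b2n (LargeImage p q S A) + N ∎
    where open ≤-Reasoning

  sum-imageSize-bound : ∀ {j} → j ^ q ≤ n ^ p →
                        4 * j * sumInputs (imageSize S) ≤ 4 * j * N * numLarge p q S + N * M
  sum-imageSize-bound {j} jᵠ≤nᵖ = begin
    4 * j * sumInputs (imageSize S)
      ≡⟨ ∑-distribˡ-* s (4 * j) _ ⟨
    sumInputs (λ A → 4 * j * imageSize S A)
      ≤⟨ ∑-mono-≤ s (imageSize-bound jᵠ≤nᵖ) ⟩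
    sumInputs (λ A → 4 * j * N * b2n (LargeImage p q S A) + N)
      ≡⟨ ∑-distrib-+ s _ _ ⟩
    sumInputs (λ A → 4 * j * N * b2n (LargeImage p q S A)) + sumInputs (λ _ → N)
      ≡⟨ cong₂ _+_ (∑-distribˡ-* s (4 * j * N) _) (trans (∑-const s N) (cong (N *_) (sumVec-ones N r))) ⟩
    4 * j * N * numLarge p q S + N * M ∎
    where
    open ≤-Reasoning
    s = sumInputs-isSummation

  numLegal≤numSolved*[1+j] : ∀ {j} → SolvesFraction p q S → n ^ p < suc j ^ q → numLegal n ≤ numSolved S * suc j
  numLegal≤numSolved*[1+j] {j} solves nᵖ<[1+j]ᵠ = ^-cancelˡ-≤ q (begin
    numLegal n ^ q                 ≤⟨ solves ⟩
    numSolved S ^ q * n ^ p        ≤⟨ *-monoʳ-≤ (numSolved S ^ q) (<⇒≤ nᵖ<[1+j]ᵠ) ⟩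
    numSolved S ^ q * suc j ^ q    ≡⟨ ^-distrib-* (numSolved S) (suc j) q ⟨
    (numSolved S * suc j) ^ q      ∎)
    where open ≤-Reasoning

  numLarge-lower-bound : ∀ {j} → SolvesFraction p q S → j ^ q ≤ n ^ p → n ^ p < suc j ^ q →
                      15 * M ≤ 68 * numLarge p q S * j
  numLarge-lower-bound {zero} _ _ nᵖ<1 = contradiction (m^n>0 n p) (<⇒≱ (subst (n ^ p <_) (^-zeroˡ q) nᵖ<1))
  numLarge-lower-bound {suc j} solves jᵠ≤nᵖ nᵖ<[1+j]ᵠ = *-cancelˡ-≤ N (+-cancelʳ-≤ (17 * (N * M)) _ _ (begin
    N * (15 * M) + 17 * (N * M)      ≡⟨ split N M ⟩
    2 * (16 * N * M)                 ≤⟨ *-monoʳ-≤ 2 legal-fraction ⟩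
    2 * (17 * L)                     ≡⟨ x∙yz≈y∙xz 2 17 L ⟩
    17 * (2 * L)                     ≤⟨ *-monoʳ-≤ 17 (*-monoʳ-≤ 2 L≤Sol*[2+j]) ⟩
    17 * (2 * (Sol * suc (suc j)))   ≤⟨ *-monoʳ-≤ 17 (*-monoʳ-≤ 2 (*-monoˡ-≤ (suc (suc j)) numSolved≤sum-imageSize)) ⟩
    17 * (2 * (T * suc (suc j)))     ≤⟨ *-monoʳ-≤ 17 (2[2+j]≤4[1+j] T j) ⟩
    17 * (4 * suc j * T)             ≤⟨ *-monoʳ-≤ 17 (sum-imageSize-bound jᵠ≤nᵖ) ⟩
    17 * (4 * suc j * N * G + N * M) ≡⟨ collect N M G (suc j) ⟩
    N * (68 * G * suc j) + 17 * (N * M) ∎))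
    where
    open ≤-Reasoning
    L = numLegal n
    Sol = numSolved S
    T = sumInputs (imageSize S)
    G = numLarge p q S
    L≤Sol*[2+j] : L ≤ Sol * suc (suc j)
    L≤Sol*[2+j] = numLegal≤numSolved*[1+j] solves nᵖ<[1+j]ᵠ
    split : ∀ N M → N * (15 * M) + 17 * (N * M) ≡ 2 * (16 * N * M)
    split = solve-∀
    collect : ∀ N M G j → 17 * (4 * j * N * G + N * M) ≡ N * (68 * G * j) + 17 * (N * M)
    collect = solve-∀
    2[2+j]≤4[1+j] : ∀ T j → 2 * (T * suc (suc j)) ≤ 4 * suc j * T
    2[2+j]≤4[1+j] T j =
      subst₂ _≤_ (expand₂ T j) (expand₄ T j) (+-monoʳ-≤ (4 * T) (*-monoˡ-≤ (T * j) {2} {4} (s≤s (s≤s z≤n))))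
      where
      expand₂ : ∀ T j → 4 * T + 2 * (T * j) ≡ 2 * (T * suc (suc j))
      expand₂ = solve-∀
      expand₄ : ∀ T j → 4 * T + 4 * (T * j) ≡ 4 * suc j * T
      expand₄ = solve-∀

corollary4p2 : (p q : ℕ) → NonZero p → NonZero q →
    Σ ℕ λ a → Σ ℕ λ b → NonZero a × NonZero b × Σ ℕ λ n₀ →
      (n : ℕ) → n₀ ≤ n → (S : SubsetSumAlg n) → SolvesFraction p q S →
        (a * Nof n ^ rof n) ^ q ≤ (b * numLarge p q S) ^ q * n ^ p
corollary4p2 p q _ q≢0 = 15 , 68 , _ , _ , 1 , bound
  where
  instance _ = q≢0
  open Algorithm using (numLarge-lower-bound)
  bound : (n : ℕ) → 1 ≤ n → (S : SubsetSumAlg n) → SolvesFraction p q S →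
          (15 * Nof n ^ rof n) ^ q ≤ (68 * numLarge p q S) ^ q * n ^ p
  bound n@(suc _) _ S solves with integerRoot q (n ^ p)
  ... | j , jᵠ≤nᵖ , nᵖ<[1+j]ᵠ = begin
    (15 * Nof n ^ rof n) ^ q          ≤⟨ ^-monoˡ-≤ q (numLarge-lower-bound p q S solves jᵠ≤nᵖ nᵖ<[1+j]ᵠ) ⟩
    (68 * numLarge p q S * j) ^ q     ≡⟨ ^-distrib-* (68 * numLarge p q S) j q ⟩
    (68 * numLarge p q S) ^ q * j ^ q ≤⟨ *-monoʳ-≤ ((68 * numLarge p q S) ^ q) jᵠ≤nᵖ ⟩
    (68 * numLarge p q S) ^ q * n ^ p ∎
    where open ≤-Reasoning
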